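{- The $\sigma$-normal terms, trails and substitutions of $\mathrm{CAU}^-_\sigma$ coincide with those generated by the grammar $M,N ::= 1 \mid 1[{\uparrow}^n] \mid \lambda.M \mid M\,N \mid \mathsf{let}(M,N) \mid !_qM \mid q\triangleright M \mid \iota(\vartheta)$, $q,q' ::= \mathsf{r} \mid \mathsf{t}(q,q') \mid \mathsf{ba} \mid \mathsf{bb} \mid \mathsf{ti} \mid \mathsf{lam}(q) \mid \mathsf{app}(q,q') \mid \mathsf{let}(q,q') \mid \mathsf{tr}(\zeta)$, $s,t ::= \langle\rangle \mid {\uparrow}^n \mid M\cdot s$.
   Context: The calculus $\mathrm{CAU}^-_\sigma$ uses nameless (de Bruijn) syntax: Terms $M,N ::= 1 \mid \lambda.M \mid M\,N \mid \mathsf{let}(M,N) \mid !_q M \mid q \triangleright M \mid \iota(\vartheta) \mid M[s] \mid \mathrm{er}(M)$; Trails $q ::= \mathsf{r} \mid \mathsf{t}(q,q') \mid \mathsf{ba} \mid \mathsf{bb} \mid \mathsf{ti} \mid \mathsf{lam}(q) \mid \mathsf{app}(q,q') \mid \mathsf{let}(q,q') \mid \mathsf{tr}(\zeta) \mid \mathrm{tl}(M)$; Substitutions $s,t ::= \langle\rangle \mid {\uparrow} \mid M\cdot s \mid s\circ t$. $\vartheta=\{M_1,\dots,M_9\}$ (resp. $\zeta=\{q_1,\dots,q_9\}$) is a family of nine terms (resp. trails); in the grammar of the claim its components are themselves generated by that grammar. $\mathrm{er}$ is explicit trail erasure, $\mathrm{tl}$ explicit trail extraction, $M[s]$ explicit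 substitution. ${\uparrow}^n={\uparrow}\circ\cdots\circ{\uparrow}$ ($n\ge 1$ times). $\sigma$-rules (applicable to any subterm, subtrail or subsubstitution): $1[\langle\rangle]\to 1$; $1[M\cdot s]\to M$; $(\lambda.M)[s]\to \lambda.(M[1\cdot(s\circ{\uparrow})])$; $(M\,N)[s]\to M[s]\,N[s]$; $(!_qM)[s]\to !_q(M[s])$; $\mathsf{let}(M,N)[s]\to\mathsf{let}(M[s],N[1\cdot(s\circ{\uparrow})])$; $(q\triangleright M)[s]\to q\triangleright(M[s])$; $\iota(\{M_i\})[s]\to\iota(\{M_i[s]\})$; $M[s][t]\to M[s\circ t]$; $\langle\rangle\circ s\to s$; ${\uparrow}\circ\langle\rangle\to{\uparrow}$; ${\uparrow}\circ(M\cdot s)\to s$; $(M\cdot s)\circ t\to M[t]\cdot(s\circ t)$; $(s_1\circ s_2)\circ s_3\to s_1\circ(s_2\circ s_3)$; $\mathrm{er}(1)\to 1$; $\mathrm{er}(1[{\uparrow}^n])\to 1[{\uparrow}^n]$; $\mathrm{er}(\lambda.M)\to\lambda.\mathrm{er}(M)$; $\mathrm{er}(M\,N)\to\mathrm{er}(M)\,\mathrm{er}(N)$; $\mathrm{er}(!_qM)\to !_qM$; $\mathrm{er}(\mathsf{let}(M,N))\to\mathsf{let}(\mathrm{er}(M),\mathrm{er}(N))$; $\mathrm{er}(q\triangleright M)\to\mathrm{er}(M)$; $\mathrm{er}(\iota(\{M_i\}))\to\iota(\{\mathrm{er}(M_i)\})$; $\mathrm{tl}(1)\to\mathsf{r}$;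 $\mathrm{tl}(1[{\uparrow}^n])\to\mathsf{r}$; $\mathrm{tl}(\lambda.M)\to\mathsf{lam}(\mathrm{tl}(M))$; $\mathrm{tl}(M\,N)\to\mathsf{app}(\mathrm{tl}(M),\mathrm{tl}(N))$; $\mathrm{tl}(!_qM)\to\mathsf{r}$; $\mathrm{tl}(\mathsf{let}(M,N))\to\mathsf{let}(\mathrm{tl}(M),\mathrm{tl}(N))$; $\mathrm{tl}(q\triangleright M)\to\mathsf{t}(q,\mathrm{tl}(M))$; $\mathrm{tl}(\iota(\{M_i\}))\to\mathsf{tr}(\{\mathrm{tl}(M_i)\})$. A $\sigma$-normal object is one to which no $\sigma$-rule applies. -}

module Defs where

open import Data.Nat using (ℕ; zero; suc)
open import Data.Fin using (Fin)
open import Data.Vec.Functional using (updateAt)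
open import Data.Product using (∃)
open import Relation.Nullary using (¬_)
open import Function using (const)

infixl 9 _[_]
infixr 6 _·_
infixr 7 _▷_
infixr 5 _∘_
infix 4 _⟶T_ _⟶Q_ _⟶S_

mutual
  data Term : Set where
    one   : Term                          -- de Bruijn index 1
    lam   : Term → Term
    app   : Term → Term → Term
    let'  : Term → Term → Term
    bang  : Trail → Term → Term
    _▷_   : Trail → Term → Term
    ι     : (Fin 9 → Term) → Term
    _[_]  : Term → Subst → Term
    er    : Term → Term

  data Trail : Set where
    r    : Trail
    t    : Trail → Trail → Trail
    ba   : Trail
    bb   : Trail
    ti   : Trail
    lamq : Trail → Trail
    appq : Trail → Trail → Trail
    letq : Trail → Trail → Trail
    tr   : (Fin 9 → Trail) → Trail
    tl   : Term → Trail

  data Subst : Set where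
    ⟨⟩   : Subst
    ↑    : Subst
    _·_  : Term → Subst → Subst
    _∘_  : Subst → Subst → Subst

-- ↑^(n+1) = ↑ ∘ (↑ ∘ (⋯ ∘ ↑))  (n+1 copies, right-associated)
↑^suc : ℕ → Subst
↑^suc zero    = ↑
↑^suc (suc n) = ↑ ∘ ↑^suc n

mutual
  data _⟶T_ : Term → Term → Set where
    s-1⟨⟩   : one [ ⟨⟩ ] ⟶T one
    s-1·    : ∀ {M s} → one [ M · s ] ⟶T M
    s-lam   : ∀ {M s} → (lam M) [ s ] ⟶T lam (M [ one · (s ∘ ↑) ])
    s-app   : ∀ {M N s} → (app M N) [ s ] ⟶T app (M [ s ]) (N [ s ])
    s-bang  : ∀ {q M s} → (bang q M) [ s ] ⟶T bang q (M [ s ])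
    s-let   : ∀ {M N s} → (let' M N) [ s ] ⟶T let' (M [ s ]) (N [ one · (s ∘ ↑) ])
    s-▷     : ∀ {q M s} → (q ▷ M) [ s ] ⟶T q ▷ (M [ s ])
    s-ι     : ∀ {ϑ s} → (ι ϑ) [ s ] ⟶T ι (λ i → ϑ i [ s ])
    s-clos  : ∀ {M s u} → M [ s ] [ u ] ⟶T M [ s ∘ u ]
    e-1     : er one ⟶T one
    e-1↑    : ∀ n → er (one [ ↑^suc n ]) ⟶T one [ ↑^suc n ]
    e-lam   : ∀ {M} → er (lam M) ⟶T lam (er M)
    e-app   : ∀ {M N} → er (app M N) ⟶T app (er M) (er N)
    e-bang  : ∀ {q M} → er (bang q M) ⟶T bang q M
    e-let   : ∀ {M N} → er (let' M N) ⟶T let' (er M) (er N)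
    e-▷     : ∀ {q M} → er (q ▷ M) ⟶T er M
    e-ι     : ∀ {ϑ} → er (ι ϑ) ⟶T ι (λ i → er (ϑ i))
    c-lam   : ∀ {M M'} → M ⟶T M' → lam M ⟶T lam M'
    c-appˡ  : ∀ {M M' N} → M ⟶T M' → app M N ⟶T app M' N
    c-appʳ  : ∀ {M N N'} → N ⟶T N' → app M N ⟶T app M N'
    c-letˡ  : ∀ {M M' N} → M ⟶T M' → let' M N ⟶T let' M' N
    c-letʳ  : ∀ {M N N'} → N ⟶T N' → let' M N ⟶T let' M N'
    c-bangq : ∀ {q q' M} → q ⟶Q q' → bang q M ⟶T bang q' M
    c-bangM : ∀ {q M M'} → M ⟶T M' → bang q M ⟶T bang q M'
    c-▷q    : ∀ {q q' M} → q ⟶Q q' → q ▷ M ⟶T q' ▷ M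
    c-▷M    : ∀ {q M M'} → M ⟶T M' → q ▷ M ⟶T q ▷ M'
    c-ι     : ∀ {ϑ M'} i → ϑ i ⟶T M' → ι ϑ ⟶T ι (updateAt ϑ i (const M'))
    c-subM  : ∀ {M M' s} → M ⟶T M' → M [ s ] ⟶T M' [ s ]
    c-subs  : ∀ {M s s'} → s ⟶S s' → M [ s ] ⟶T M [ s' ]
    c-er    : ∀ {M M'} → M ⟶T M' → er M ⟶T er M'

  data _⟶Q_ : Trail → Trail → Set where
    l-1     : tl one ⟶Q r
    l-1↑    : ∀ n → tl (one [ ↑^suc n ]) ⟶Q r
    l-lam   : ∀ {M} → tl (lam M) ⟶Q lamq (tl M)
    l-app   : ∀ {M N} → tl (app M N) ⟶Q appq (tl M) (tl N)
    l-bang  : ∀ {q M} → tl (bang q M) ⟶Q r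
    l-let   : ∀ {M N} → tl (let' M N) ⟶Q letq (tl M) (tl N)
    l-▷     : ∀ {q M} → tl (q ▷ M) ⟶Q t q (tl M)
    l-ι     : ∀ {ϑ} → tl (ι ϑ) ⟶Q tr (λ i → tl (ϑ i))
    c-tˡ    : ∀ {q q' p} → q ⟶Q q' → t q p ⟶Q t q' p
    c-tʳ    : ∀ {q p p'} → p ⟶Q p' → t q p ⟶Q t q p'
    c-lamq  : ∀ {q q'} → q ⟶Q q' → lamq q ⟶Q lamq q'
    c-appqˡ : ∀ {q q' p} → q ⟶Q q' → appq q p ⟶Q appq q' p
    c-appqʳ : ∀ {q p p'} → p ⟶Q p' → appq q p ⟶Q appq q p'
    c-letqˡ : ∀ {q q' p} → q ⟶Q q' → letq q p ⟶Q letq q' p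
    c-letqʳ : ∀ {q p p'} → p ⟶Q p' → letq q p ⟶Q letq q p'
    c-tr    : ∀ {ζ q'} i → ζ i ⟶Q q' → tr ζ ⟶Q tr (updateAt ζ i (const q'))
    c-tl    : ∀ {M M'} → M ⟶T M' → tl M ⟶Q tl M'

  data _⟶S_ : Subst → Subst → Set where
    s-⟨⟩∘   : ∀ {s} → ⟨⟩ ∘ s ⟶S s
    s-↑∘⟨⟩  : ↑ ∘ ⟨⟩ ⟶S ↑
    s-↑∘·   : ∀ {M s} → ↑ ∘ (M · s) ⟶S s
    s-·∘    : ∀ {M s u} → (M · s) ∘ u ⟶S (M [ u ]) · (s ∘ u)
    s-assoc : ∀ {s₁ s₂ s₃} → (s₁ ∘ s₂) ∘ s₃ ⟶S s₁ ∘ (s₂ ∘ s₃)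
    c-·M    : ∀ {M M' s} → M ⟶T M' → M · s ⟶S M' · s
    c-·s    : ∀ {M s s'} → s ⟶S s' → M · s ⟶S M · s'
    c-∘ˡ    : ∀ {s s' u} → s ⟶S s' → s ∘ u ⟶S s' ∘ u
    c-∘ʳ    : ∀ {s u u'} → u ⟶S u' → s ∘ u ⟶S s ∘ u'

σNormalT : Term → Set
σNormalT M = ¬ ∃ (λ N → M ⟶T N)

σNormalQ : Trail → Set
σNormalQ q = ¬ ∃ (λ q' → q ⟶Q q')

σNormalS : Subst → Set
σNormalS s = ¬ ∃ (λ s' → s ⟶S s')

mutual
  data GT : Term → Set where
    g-1    : GT one
    g-1↑   : ∀ n → GT (one [ ↑^suc n ])
    g-lam  : ∀ {M} → GT M → GT (lam M)
    g-app  : ∀ {M N} → GT M → GT N → GT (app M N)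
    g-let  : ∀ {M N} → GT M → GT N → GT (let' M N)
    g-bang : ∀ {q M} → GQ q → GT M → GT (bang q M)
    g-▷    : ∀ {q M} → GQ q → GT M → GT (q ▷ M)
    g-ι    : ∀ {ϑ} → (∀ i → GT (ϑ i)) → GT (ι ϑ)

  data GQ : Trail → Set where
    g-r    : GQ r
    g-t    : ∀ {q p} → GQ q → GQ p → GQ (t q p)
    g-ba   : GQ ba
    g-bb   : GQ bb
    g-ti   : GQ ti
    g-lamq : ∀ {q} → GQ q → GQ (lamq q)
    g-appq : ∀ {q p} → GQ q → GQ p → GQ (appq q p)
    g-letq : ∀ {q p} → GQ q → GQ p → GQ (letq q p)
    g-tr   : ∀ {ζ} → (∀ i → GQ (ζ i)) → GQ (tr ζ)

  data GS : Subst → Set where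
    g-⟨⟩   : GS ⟨⟩
    g-↑    : ∀ n → GS (↑^suc n)
    g-·    : ∀ {M s} → GT M → GS s → GS (M · s)

-- Every object either has a σ-step or is generated by the grammar, by structural
-- recursion; the delicate cases are er(M)[s], er(er M), er(M[s]) and tl(M[s]), where
-- the inner object must itself reduce because no grammar term is an erasure and
-- the only grammar closure is 1[↑ⁿ]. Conversely grammar objects are stuck: ↑ ∘ s
-- only reduces when s is ⟨⟩ or a cons, so 1[↑ⁿ] and ↑ⁿ admit no step, and every
-- other case is a congruence.
module Submission where

open import Defs
open import Data.Nat using (zero; suc)
open import Data.Fin using (Fin; zero; suc)
open import Data.Product using (_×_; _,_; ∃)
open import Data.Sum using (_⊎_; inj₁; inj₂)
open import Relation.Nullary using (¬_; contradiction)
open import Function.Bundles using (_⇔_; mk⇔)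

∃⊎∀ : ∀ {n} {A B : Fin n → Set} → (∀ i → A i ⊎ B i) → ∃ A ⊎ (∀ i → B i)
∃⊎∀ {zero}  f = inj₂ λ ()
∃⊎∀ {suc n} f with f zero | ∃⊎∀ (λ i → f (suc i))
... | inj₁ a | _            = inj₁ (zero , a)
... | inj₂ _ | inj₁ (i , a) = inj₁ (suc i , a)
... | inj₂ b | inj₂ g       = inj₂ λ { zero → b ; (suc i) → g i }

Reducible : {A : Set} → (A → A → Set) → A → Set
Reducible _⟶_ x = ∃ λ y → x ⟶ y

mutual
  reducible⊎GT : ∀ M → Reducible _⟶T_ M ⊎ GT M
  reducible⊎GT one = inj₂ g-1
  reducible⊎GT (lam M) with reducible⊎GT M
  ... | inj₁ (_ , st) = inj₁ (_ , c-lam st)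
  ... | inj₂ g        = inj₂ (g-lam g)
  reducible⊎GT (app M N) with reducible⊎GT M | reducible⊎GT N
  ... | inj₁ (_ , st) | _             = inj₁ (_ , c-appˡ st)
  ... | inj₂ _        | inj₁ (_ , st) = inj₁ (_ , c-appʳ st)
  ... | inj₂ g        | inj₂ h        = inj₂ (g-app g h)
  reducible⊎GT (let' M N) with reducible⊎GT M | reducible⊎GT N
  ... | inj₁ (_ , st) | _             = inj₁ (_ , c-letˡ st)
  ... | inj₂ _        | inj₁ (_ , st) = inj₁ (_ , c-letʳ st)
  ... | inj₂ g        | inj₂ h        = inj₂ (g-let g h)
  reducible⊎GT (bang q M) with reducible⊎GQ q | reducible⊎GT M
  ... | inj₁ (_ , st) | _             = inj₁ (_ , c-bangq st)
  ... | inj₂ _        | inj₁ (_ , st) = inj₁ (_ , c-bangM st)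
  ... | inj₂ g        | inj₂ h        = inj₂ (g-bang g h)
  reducible⊎GT (q ▷ M) with reducible⊎GQ q | reducible⊎GT M
  ... | inj₁ (_ , st) | _             = inj₁ (_ , c-▷q st)
  ... | inj₂ _        | inj₁ (_ , st) = inj₁ (_ , c-▷M st)
  ... | inj₂ g        | inj₂ h        = inj₂ (g-▷ g h)
  reducible⊎GT (ι ϑ) with ∃⊎∀ (λ i → reducible⊎GT (ϑ i))
  ... | inj₁ (i , _ , st) = inj₁ (_ , c-ι i st)
  ... | inj₂ g            = inj₂ (g-ι g)
  reducible⊎GT (one [ s ]) with reducible⊎GS s
  ... | inj₁ (_ , st)    = inj₁ (_ , c-subs st)
  ... | inj₂ g-⟨⟩        = inj₁ (_ , s-1⟨⟩)
  ... | inj₂ (g-· _ _)   = inj₁ (_ , s-1·)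
  ... | inj₂ (g-↑ n)     = inj₂ (g-1↑ n)
  reducible⊎GT (lam M [ s ])    = inj₁ (_ , s-lam)
  reducible⊎GT (app M N [ s ])  = inj₁ (_ , s-app)
  reducible⊎GT (let' M N [ s ]) = inj₁ (_ , s-let)
  reducible⊎GT (bang q M [ s ]) = inj₁ (_ , s-bang)
  reducible⊎GT ((q ▷ M) [ s ])  = inj₁ (_ , s-▷)
  reducible⊎GT (ι ϑ [ s ])      = inj₁ (_ , s-ι)
  reducible⊎GT (M [ u ] [ s ])  = inj₁ (_ , s-clos)
  reducible⊎GT (er M [ s ]) with reducible⊎GT (er M)
  ... | inj₁ (_ , st) = inj₁ (_ , c-subM st)
  ... | inj₂ ()
  reducible⊎GT (er one)        = inj₁ (_ , e-1)
  reducible⊎GT (er (lam M))    = inj₁ (_ , e-lam)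
  reducible⊎GT (er (app M N))  = inj₁ (_ , e-app)
  reducible⊎GT (er (let' M N)) = inj₁ (_ , e-let)
  reducible⊎GT (er (bang q M)) = inj₁ (_ , e-bang)
  reducible⊎GT (er (q ▷ M))    = inj₁ (_ , e-▷)
  reducible⊎GT (er (ι ϑ))      = inj₁ (_ , e-ι)
  reducible⊎GT (er (er M)) with reducible⊎GT (er M)
  ... | inj₁ (_ , st) = inj₁ (_ , c-er st)
  ... | inj₂ ()
  reducible⊎GT (er (M [ s ])) with reducible⊎GT (M [ s ])
  ... | inj₁ (_ , st) = inj₁ (_ , c-er st)
  ... | inj₂ (g-1↑ n) = inj₁ (_ , e-1↑ n)

  reducible⊎GQ : ∀ q → Reducible _⟶Q_ q ⊎ GQ q
  reducible⊎GQ r  = inj₂ g-r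
  reducible⊎GQ ba = inj₂ g-ba
  reducible⊎GQ bb = inj₂ g-bb
  reducible⊎GQ ti = inj₂ g-ti
  reducible⊎GQ (t q p) with reducible⊎GQ q | reducible⊎GQ p
  ... | inj₁ (_ , st) | _             = inj₁ (_ , c-tˡ st)
  ... | inj₂ _        | inj₁ (_ , st) = inj₁ (_ , c-tʳ st)
  ... | inj₂ g        | inj₂ h        = inj₂ (g-t g h)
  reducible⊎GQ (lamq q) with reducible⊎GQ q
  ... | inj₁ (_ , st) = inj₁ (_ , c-lamq st)
  ... | inj₂ g        = inj₂ (g-lamq g)
  reducible⊎GQ (appq q p) with reducible⊎GQ q | reducible⊎GQ p
  ... | inj₁ (_ , st) | _             = inj₁ (_ , c-appqˡ st)
  ... | inj₂ _        | inj₁ (_ , st) = inj₁ (_ , c-appqʳ st)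
  ... | inj₂ g        | inj₂ h        = inj₂ (g-appq g h)
  reducible⊎GQ (letq q p) with reducible⊎GQ q | reducible⊎GQ p
  ... | inj₁ (_ , st) | _             = inj₁ (_ , c-letqˡ st)
  ... | inj₂ _        | inj₁ (_ , st) = inj₁ (_ , c-letqʳ st)
  ... | inj₂ g        | inj₂ h        = inj₂ (g-letq g h)
  reducible⊎GQ (tr ζ) with ∃⊎∀ (λ i → reducible⊎GQ (ζ i))
  ... | inj₁ (i , _ , st) = inj₁ (_ , c-tr i st)
  ... | inj₂ g            = inj₂ (g-tr g)
  reducible⊎GQ (tl one)        = inj₁ (_ , l-1)
  reducible⊎GQ (tl (lam M))    = inj₁ (_ , l-lam)
  reducible⊎GQ (tl (app M N))  = inj₁ (_ , l-app)
  reducible⊎GQ (tl (let' M N)) = inj₁ (_ , l-let)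
  reducible⊎GQ (tl (bang q M)) = inj₁ (_ , l-bang)
  reducible⊎GQ (tl (q ▷ M))    = inj₁ (_ , l-▷)
  reducible⊎GQ (tl (ι ϑ))      = inj₁ (_ , l-ι)
  reducible⊎GQ (tl (er M)) with reducible⊎GT (er M)
  ... | inj₁ (_ , st) = inj₁ (_ , c-tl st)
  ... | inj₂ ()
  reducible⊎GQ (tl (M [ s ])) with reducible⊎GT (M [ s ])
  ... | inj₁ (_ , st) = inj₁ (_ , c-tl st)
  ... | inj₂ (g-1↑ n) = inj₁ (_ , l-1↑ n)

  reducible⊎GS : ∀ s → Reducible _⟶S_ s ⊎ GS s
  reducible⊎GS ⟨⟩ = inj₂ g-⟨⟩
  reducible⊎GS ↑  = inj₂ (g-↑ zero)
  reducible⊎GS (M · s) with reducible⊎GT M | reducible⊎GS s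
  ... | inj₁ (_ , st) | _             = inj₁ (_ , c-·M st)
  ... | inj₂ _        | inj₁ (_ , st) = inj₁ (_ , c-·s st)
  ... | inj₂ g        | inj₂ h        = inj₂ (g-· g h)
  reducible⊎GS (⟨⟩ ∘ u)        = inj₁ (_ , s-⟨⟩∘)
  reducible⊎GS ((M · s) ∘ u)   = inj₁ (_ , s-·∘)
  reducible⊎GS ((s₁ ∘ s₂) ∘ u) = inj₁ (_ , s-assoc)
  reducible⊎GS (↑ ∘ u) with reducible⊎GS u
  ... | inj₁ (_ , st)  = inj₁ (_ , c-∘ʳ st)
  ... | inj₂ g-⟨⟩      = inj₁ (_ , s-↑∘⟨⟩)
  ... | inj₂ (g-· _ _) = inj₁ (_ , s-↑∘·)
  ... | inj₂ (g-↑ n)   = inj₂ (g-↑ (suc n))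

↑^suc-irreducible : ∀ n {s} → ¬ (↑^suc n ⟶S s)
↑^suc-irreducible zero          ()
↑^suc-irreducible (suc zero)    (c-∘ʳ ())
↑^suc-irreducible (suc (suc n)) (c-∘ʳ st) = ↑^suc-irreducible (suc n) st

one[↑^suc]-irreducible : ∀ n {M} → ¬ (one [ ↑^suc n ] ⟶T M)
one[↑^suc]-irreducible zero    (c-subs st) = ↑^suc-irreducible zero st
one[↑^suc]-irreducible (suc n) (c-subs st) = ↑^suc-irreducible (suc n) st

mutual
  GT-irreducible : ∀ {M N} → GT M → ¬ (M ⟶T N)
  GT-irreducible g-1 ()
  GT-irreducible (g-1↑ n)     st           = one[↑^suc]-irreducible n st
  GT-irreducible (g-lam g)    (c-lam st)   = GT-irreducible g st
  GT-irreducible (g-app g _)  (c-appˡ st)  = GT-irreducible g st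
  GT-irreducible (g-app _ h)  (c-appʳ st)  = GT-irreducible h st
  GT-irreducible (g-let g _)  (c-letˡ st)  = GT-irreducible g st
  GT-irreducible (g-let _ h)  (c-letʳ st)  = GT-irreducible h st
  GT-irreducible (g-bang g _) (c-bangq st) = GQ-irreducible g st
  GT-irreducible (g-bang _ h) (c-bangM st) = GT-irreducible h st
  GT-irreducible (g-▷ g _)    (c-▷q st)    = GQ-irreducible g st
  GT-irreducible (g-▷ _ h)    (c-▷M st)    = GT-irreducible h st
  GT-irreducible (g-ι f)      (c-ι i st)   = GT-irreducible (f i) st

  GQ-irreducible : ∀ {q p} → GQ q → ¬ (q ⟶Q p)
  GQ-irreducible g-r ()
  GQ-irreducible g-ba ()
  GQ-irreducible g-bb ()
  GQ-irreducible g-ti ()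
  GQ-irreducible (g-t g _)    (c-tˡ st)    = GQ-irreducible g st
  GQ-irreducible (g-t _ h)    (c-tʳ st)    = GQ-irreducible h st
  GQ-irreducible (g-lamq g)   (c-lamq st)  = GQ-irreducible g st
  GQ-irreducible (g-appq g _) (c-appqˡ st) = GQ-irreducible g st
  GQ-irreducible (g-appq _ h) (c-appqʳ st) = GQ-irreducible h st
  GQ-irreducible (g-letq g _) (c-letqˡ st) = GQ-irreducible g st
  GQ-irreducible (g-letq _ h) (c-letqʳ st) = GQ-irreducible h st
  GQ-irreducible (g-tr f)     (c-tr i st)  = GQ-irreducible (f i) st

GS-irreducible : ∀ {s u} → GS s → ¬ (s ⟶S u)
GS-irreducible g-⟨⟩ ()
GS-irreducible (g-↑ n)   st         = ↑^suc-irreducible n st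
GS-irreducible (g-· g _) (c-·M st) = GT-irreducible g st
GS-irreducible (g-· _ h) (c-·s st) = GS-irreducible h st

normal⇔ : {A : Set} {_⟶_ : A → A → Set} {G : A → Set} →
          (∀ x → Reducible _⟶_ x ⊎ G x) → (∀ {x y} → G x → ¬ (x ⟶ y)) →
          ∀ x → (¬ Reducible _⟶_ x) ⇔ G x
normal⇔ {_⟶_ = _⟶_} {G} progress stuck x = mk⇔ normal⇒G (λ g (_ , st) → stuck g st)
  where
  normal⇒G : ¬ Reducible _⟶_ x → G x
  normal⇒G normal with progress x
  ... | inj₁ red = contradiction red normal
  ... | inj₂ g   = g

lemma2 : ((M : Term) → σNormalT M ⇔ GT M) × ((q : Trail) → σNormalQ q ⇔ GQ q) × ((s : Subst) → σNormalS s ⇔ GS s)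
lemma2 = normal⇔ reducible⊎GT GT-irreducible
       , normal⇔ reducible⊎GQ GQ-irreducible
       , normal⇔ reducible⊎GS GS-irreducible
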